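{- Let $G=(V,E)$ be a connected graph of maximum degree at most $d$ and $\chi:V\to\{0,1\}$ with $\sum_{v\in V}\chi(v)$ odd. Let $A$ be a clause of the Tseitin formula $\mathrm{Ts}(G,\chi)$, let $\mathbb{C}$ be a set of clauses over the edge variables, and let $\mathbb{C}'=\mathbb{C}\cup\{A\}$. Then $d\cdot\mu(\mathbb{C}')+1\ge\mu(\mathbb{C})$.
   Context: Associate a Boolean variable $x_e$ with each edge $e\in E$. For $v\in V$, $\mathrm{PARITY}_{v,\chi}$ is the canonical CNF encoding of $\sum_{e\ni v}x_e\equiv\chi(v)\pmod 2$ (one clause over the incident edge variables for each violating assignment, falsified exactly by it), and $\mathrm{Ts}(G,\chi)=\bigwedge_{v\in V}\mathrm{PARITY}_{v,\chi}$. For a term (conjunction of literals) $T$, the term measure is $\mu_T(T)=\min\{|V'| : V'\subseteq V,\ T\land\bigwedge_{v\in V'}\mathrm{PARITY}_{v,\chi}\vDash 0\}$ (i.e., the conjunction is unsatisfiable). For a set of clauses $\mathbb{C}$ (identified with their conjunction), $\mu(\mathbb{C})=\max\{\mu_T(T): T \text{ a term with } T\vDash\mathbb{C}\}$, and $\mu(\mathbb{C})=0$ when $\mathbb{C}$ is unsatisfiable. -}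

module Defs where

open import Data.Nat using (ℕ; zero; suc; _≤_)
open import Data.Bool using (Bool; true; false; not; _xor_; _∨_)
open import Data.Fin using (Fin)
open import Data.Fin.Subset using (Subset; ∣_∣) renaming (_∈_ to _∈ₛ_)
open import Data.List using (List; []; _∷_; [_]; map; filterᵇ; concatMap; foldr; length; allFin)
open import Data.List.Relation.Unary.All using (All)
open import Data.List.Relation.Unary.Any using (Any)
open import Data.List.Membership.Propositional using (_∈_)
open import Data.Product using (Σ; ∃; _×_; _,_; proj₁; proj₂)
open import Data.Sum using (_⊎_)
open import Data.Empty using (⊥)
open import Relation.Binary.PropositionalEquality using (_≡_; _≢_)
open import Relation.Nullary using (¬_; does)
import Data.Fin as F

record Graph (n m : ℕ) : Set where
  field
    ends     : Fin m → Fin n × Fin n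
    loopless : ∀ e → proj₁ (ends e) ≢ proj₂ (ends e)
    simple   : ∀ e f → (ends e ≡ ends f ⊎ ends e ≡ (proj₂ (ends f) , proj₁ (ends f))) → e ≡ f
open Graph public

module _ {n m : ℕ} (G : Graph n m) where

  incidentᵇ : Fin n → Fin m → Bool
  incidentᵇ v e = does (proj₁ (ends G e) F.≟ v) ∨ does (proj₂ (ends G e) F.≟ v)

  incident : Fin n → List (Fin m)
  incident v = filterᵇ (incidentᵇ v) (allFin m)

  degree : Fin n → ℕ
  degree v = length (incident v)

  MaxDegreeAtMost : ℕ → Set
  MaxDegreeAtMost d = ∀ v → degree v ≤ d

  data Reach : Fin n → Fin n → Set where
    here : ∀ {u} → Reach u u
    step : ∀ {u w v} (e : Fin m) → incidentᵇ u e ≡ true → incidentᵇ w e ≡ true →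
           Reach w v → Reach u v

  Connected : Set
  Connected = ∀ u v → Reach u v

Literal : ℕ → Set
Literal m = Fin m × Bool     -- (e , b) is x_e if b = true, ¬x_e if b = false

Clause : ℕ → Set
Clause m = List (Literal m)

Term : ℕ → Set
Term m = List (Literal m)

CNF : ℕ → Set
CNF m = List (Clause m)      -- a (finite) set of clauses, i.e. their conjunction

Assignment : ℕ → Set
Assignment m = Fin m → Bool

module _ {m : ℕ} where

  SatLit : Assignment m → Literal m → Set
  SatLit α (e , b) = α e ≡ b

  SatClause : Assignment m → Clause m → Set
  SatClause α C = Any (SatLit α) C

  SatTerm : Assignment m → Term m → Set
  SatTerm α T = All (SatLit α) T

  SatCNF : Assignment m → CNF m → Set
  SatCNF α F = All (SatClause α) F

  Unsatisfiable : CNF m → Set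
  Unsatisfiable F = ∀ α → ¬ SatCNF α F

  Satisfiable : CNF m → Set
  Satisfiable F = ∃ λ α → SatCNF α F

  _⊨_ : Term m → CNF m → Set
  T ⊨ F = ∀ α → SatTerm α T → SatCNF α F

  -- all full terms (assignments written as terms) over a list of edges
  allTerms : List (Fin m) → List (Term m)
  allTerms [] = [ [] ]
  allTerms (e ∷ es) = concatMap (λ t → ((e , true) ∷ t) ∷ ((e , false) ∷ t) ∷ []) (allTerms es)

  parityᵗ : Term m → Bool
  parityᵗ t = foldr (λ l b → proj₂ l xor b) false t

  -- the unique clause falsified exactly by the full term t
  falsifiedBy : Term m → Clause m
  falsifiedBy t = map (λ l → proj₁ l , not (proj₂ l)) t

module _ {n m : ℕ} (G : Graph n m) (χ : Fin n → Bool) where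

  -- canonical CNF encoding of  Σ_{e ∋ v} x_e ≡ χ(v) (mod 2):
  -- one clause per violating assignment of the incident edge variables
  PARITY : Fin n → CNF m
  PARITY v = map falsifiedBy
               (filterᵇ (λ t → parityᵗ t xor χ v) (allTerms (incident G v)))

  IsTseitinClause : Clause m → Set
  IsTseitinClause A = ∃ λ v → A ∈ PARITY v

  RefutedBy : Term m → Subset n → Set
  RefutedBy T V' = ∀ α → SatTerm α T → (∀ v → v ∈ₛ V' → SatCNF α (PARITY v)) → ⊥

  IsTermMeasure : Term m → ℕ → Set
  IsTermMeasure T k =
    (Σ (Subset n) λ V' → ∣ V' ∣ ≡ k × RefutedBy T V') ×
    (∀ V' → RefutedBy T V' → k ≤ ∣ V' ∣)

  IsMeasure : CNF m → ℕ → Set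
  IsMeasure C k =
    (Unsatisfiable C → k ≡ 0) ×
    (Satisfiable C →
      (Σ (Term m) λ T → T ⊨ C × IsTermMeasure T k) ×
      (∀ T j → T ⊨ C → IsTermMeasure T j → j ≤ k))

  OddCharge : Set
  OddCharge = foldr (λ v b → χ v xor b) false (allFin n) ≡ true

-- Write φ for the free edges of a term and call a vertex set U φ-closed if no free edge leaves
-- it.  The charge of U under an assignment is the parity of its violated vertices; it depends only
-- on the edges leaving U.  Hence a vertex set refutes a term T iff it contains a φ-closed set of
-- odd charge (the converse direction repairs an assignment one free edge at a time).
--
-- Let k = μ(C) ≥ 2 be attained by a term T ⊨ C, let A ∈ PARITY_v and let α₀ satisfy T and A (if no
-- such α₀ exists, {v} refutes T ∧ A and k ≤ 1).  Let φ' be the free edges of T not at v, and N the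
-- set consisting of v and of all vertices lying in a φ'-closed X with d |X| ≤ k - 2.  No φ-closed
-- subset U of N is odd under α₀: removing from U either U ∩ X (when v ∉ U) or v together with the
-- at most d small sets covering its free neighbours leaves a smaller odd closed set, since the
-- removed part is too small to be odd.  So α₀ can be changed on free edges to some β satisfying
-- all of N.  The term T' = T ∧ β|edges at v entails A ∧ C, hence is refuted by some W with
-- |W| ≤ μ(C ∪ {A}), and W contains a φ'-closed U of odd β-charge.  U ⊄ N, so d |U| ≥ k - 1.

module Submission where

open import Defs
open import Algebra using (CommutativeRing)
open import Data.Bool using (Bool; true; false; not; _xor_; _∧_; _∨_)
import Data.Bool as Bool
open import Data.Bool.Properties
  using (xor-identityʳ; xor-same; xor-∧-commutativeRing; ∧-comm; ∧-assoc; ∧-zeroʳ;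
         ∧-conicalˡ; ∧-conicalʳ; ∧-distribˡ-xor; ∧-distribʳ-xor; ∨-zeroʳ; ∨-conicalˡ; ∨-conicalʳ;
         not-¬; ¬-not; not-injective; T-≡)
open import Data.Empty using (⊥; ⊥-elim)
open import Data.Fin using (Fin; zero; suc; _≟_)
open import Data.Fin.Subset using (Subset; ∣_∣) renaming (_∈_ to _∈ₛ_)
open import Data.List using (List; []; _∷_; _++_; map; filterᵇ; allFin; length) renaming (tabulate to tabulateL)
open import Data.List.Membership.Propositional using (_∈_; _∉_; find; lose)
open import Data.List.Membership.Propositional.Properties
  using (∈-filter⁺; ∈-filter⁻; ∈-map⁺; ∈-map⁻; ∈-allFin; ∈-length)
open import Data.List.Relation.Unary.All using (All; []; _∷_)
import Data.List.Relation.Unary.All as All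
open import Data.List.Relation.Unary.All.Properties using (++⁺; ++⁻ˡ; ++⁻ʳ)
open import Data.List.Relation.Unary.Any using (here; there)
import Data.List.Relation.Unary.Any as Any
open import Data.List.Relation.Unary.Any.Properties using (concatMap⁺; concatMap⁻)
open import Data.Nat using (ℕ; zero; suc; _+_; _*_; _≤_; _<_; _≥_; _≤?_; z≤n; s≤s; NonZero; >-nonZero)
open import Data.Nat.Properties
  using (≤-refl; ≤-reflexive; ≤-trans; ≮⇒≥; <⇒≱; ≰⇒>; m≤n⇒m≤1+n; n≤1+n; m≤n+m; m≤n*m;
         +-suc; +-comm; +-mono-≤; +-monoˡ-≤; +-monoʳ-≤; *-zeroʳ; *-distribˡ-+;
         *-monoˡ-≤; *-monoʳ-≤; *-cancelˡ-≤; module ≤-Reasoning)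
open import Data.Product using (Σ; ∃; _×_; _,_; proj₁; proj₂; map₂)
open import Data.Sum using (_⊎_; inj₁; inj₂)
open import Data.Vec using (tabulate; lookup)
open import Data.Vec.Properties using (lookup∘tabulate; tabulate∘lookup; []=⇒lookup; lookup⇒[]=)
open import Effect.Monad using (RawMonad)
open import Function using (_∘_; id)
open import Function.Bundles using (Equivalence; _⇔_; mk⇔)
open import Level using (0ℓ)
open import Relation.Binary.PropositionalEquality
open import Relation.Nullary using (¬_; Dec; does; yes; no)
open import Relation.Nullary.Decidable using (T?; dec-true; dec-false; does-⇔; decidable-stable; ¬¬-excluded-middle)
open import Relation.Nullary.Negation using (contradiction; ¬¬-Monad)

open import Algebra.Properties.CommutativeSemigroup
  (CommutativeRing.+-commutativeSemigroup xor-∧-commutativeRing) using (interchange; xy∙z≈xz∙y)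

open RawMonad (¬¬-Monad {a = 0ℓ}) using (pure; _<$>_; _>>=_)

private variable n : ℕ

xor≡false⇒≡ : ∀ x y → x xor y ≡ false → x ≡ y
xor≡false⇒≡ true  true  _ = refl
xor≡false⇒≡ false false _ = refl

does-≟-sym : (i j : Fin n) → does (i ≟ j) ≡ does (j ≟ i)
does-≟-sym i j = does-⇔ (mk⇔ sym sym) (i ≟ j) (j ≟ i)

⨁ : (Fin n → Bool) → Bool
⨁ {zero}  f = false
⨁ {suc n} f = f zero xor ⨁ (f ∘ suc)

⨁-cong : {f g : Fin n → Bool} → (∀ i → f i ≡ g i) → ⨁ f ≡ ⨁ g
⨁-cong {zero}  f≗g = refl
⨁-cong {suc n} f≗g = cong₂ _xor_ (f≗g zero) (⨁-cong (f≗g ∘ suc))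

⨁-zero : (f : Fin n → Bool) → (∀ i → f i ≡ false) → ⨁ f ≡ false
⨁-zero {zero}  f f≗0 = refl
⨁-zero {suc n} f f≗0 rewrite f≗0 zero = ⨁-zero (f ∘ suc) (f≗0 ∘ suc)

⨁-xor : (f g : Fin n → Bool) → ⨁ (λ i → f i xor g i) ≡ ⨁ f xor ⨁ g
⨁-xor {zero}  f g = refl
⨁-xor {suc n} f g =
  trans (cong ((f zero xor g zero) xor_) (⨁-xor (f ∘ suc) (g ∘ suc)))
        (interchange (f zero) (g zero) _ _)

⨁-∧ˡ : ∀ b (f : Fin n → Bool) → ⨁ (λ i → b ∧ f i) ≡ b ∧ ⨁ f
⨁-∧ˡ {zero}  b f = sym (∧-zeroʳ b)
⨁-∧ˡ {suc n} b f =
  trans (cong ((b ∧ f zero) xor_) (⨁-∧ˡ b (f ∘ suc))) (sym (∧-distribˡ-xor b _ _))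

⨁-swap : ∀ {m} (f : Fin n → Fin m → Bool) →
         ⨁ (λ i → ⨁ (λ j → f i j)) ≡ ⨁ (λ j → ⨁ (λ i → f i j))
⨁-swap {zero} {m} f = sym (⨁-zero {m} _ (λ _ → refl))
⨁-swap {suc n} f =
  trans (cong (⨁ (f zero) xor_) (⨁-swap (f ∘ suc))) (sym (⨁-xor (f zero) _))

⨁-δ : ∀ (a : Fin n) (f : Fin n → Bool) → ⨁ (λ i → does (a ≟ i) ∧ f i) ≡ f a
⨁-δ {suc n} zero    f =
  trans (cong (f zero xor_) (⨁-zero {n} _ (λ _ → refl))) (xor-identityʳ (f zero))
⨁-δ {suc n} (suc a) f = ⨁-δ a (f ∘ suc)

⨁≡true⇒∃ : (f : Fin n → Bool) → ⨁ f ≡ true → ∃ λ i → f i ≡ true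
⨁≡true⇒∃ {suc n} f odd with f zero in fz
... | true  = zero , fz
... | false = let i , fi = ⨁≡true⇒∃ (f ∘ suc) odd in suc i , fi

-- Subsets of Fin n as Boolean functions

∅ : Fin n → Bool
∅ _ = false

⁅_⁆ : Fin n → Fin n → Bool
⁅ v ⁆ u = does (v ≟ u)

infixr 7 _∩_
infixr 6 _∪_
infixl 5 _─_ _△_

_∩_ _∪_ _─_ _△_ : (Fin n → Bool) → (Fin n → Bool) → Fin n → Bool
(U ∩ X) u = U u ∧ X u
(U △ X) u = U u xor X u
(U ∪ X) u = U u ∨ X u
(U ─ X) u = U u ∧ not (X u)

infix 4 _⊆_
_⊆_ : (Fin n → Bool) → (Fin n → Bool) → Set
U ⊆ X = ∀ i → U i ≡ true → X i ≡ true

⊆-false : {U V : Fin n → Bool} → U ⊆ V → ∀ {u} → V u ≡ false → U u ≡ false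
⊆-false {U = U} U⊆V {u} Vu with U u in Uu
... | false = refl
... | true  = trans (sym (U⊆V u Uu)) Vu

⁅⁆⊆ : {W : Fin n → Bool} {u : Fin n} → W u ≡ true → ⁅ u ⁆ ⊆ W
⁅⁆⊆ {u = u} Wu i u≡i with u ≟ i
... | yes refl = Wu

∩⊆ʳ : (U X : Fin n → Bool) → U ∩ X ⊆ X
∩⊆ʳ U X u = ∧-conicalʳ (U u) (X u)

─⊆ : (W X : Fin n → Bool) → W ─ X ⊆ W
─⊆ W X u p with W u
... | true = refl

─-∉ : {W : Fin n → Bool} (X : Fin n → Bool) {u : Fin n} → W u ≡ false → (W ─ X) u ≡ false
─-∉ X Wu rewrite Wu = refl

─⁅⁆-∉ : (W : Fin n → Bool) {x : Fin n} → (W ─ ⁅ x ⁆) x ≡ false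
─⁅⁆-∉ W {x} rewrite dec-true (x ≟ x) refl = ∧-zeroʳ (W x)

∈─⁅⁆ : {W : Fin n → Bool} {u x : Fin n} → W u ≡ true → u ≢ x → (W ─ ⁅ x ⁆) u ≡ true
∈─⁅⁆ {u = u} {x} Wu u≢x rewrite Wu | dec-false (x ≟ u) (≢-sym u≢x) = refl

∈-tabulate : (U : Fin n → Bool) {u : Fin n} → U u ≡ true → u ∈ₛ tabulate U
∈-tabulate U {u} Uu = lookup⇒[]= u (tabulate U) (trans (lookup∘tabulate U u) Uu)

card : (Fin n → Bool) → ℕ
card U = ∣ tabulate U ∣

card-mono : (U X : Fin n → Bool) → U ⊆ X → card U ≤ card X
card-mono {zero}  U X U⊆X = z≤n
card-mono {suc n} U X U⊆X with U zero in u0 | X zero in x0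
... | true  | true  = s≤s (card-mono (U ∘ suc) (X ∘ suc) (U⊆X ∘ suc))
... | true  | false = contradiction (trans (sym (U⊆X zero u0)) x0) λ ()
... | false | true  = m≤n⇒m≤1+n (card-mono (U ∘ suc) (X ∘ suc) (U⊆X ∘ suc))
... | false | false = card-mono (U ∘ suc) (X ∘ suc) (U⊆X ∘ suc)

card-< : (U X : Fin n → Bool) → U ⊆ X → ∀ w → X w ≡ true → U w ≡ false → card U < card X
card-< {suc n} U X U⊆X zero    xw uw rewrite xw | uw = s≤s (card-mono (U ∘ suc) (X ∘ suc) (U⊆X ∘ suc))
card-< {suc n} U X U⊆X (suc w) xw uw with U zero in u0 | X zero in x0
... | true  | true  = s≤s (card-< (U ∘ suc) (X ∘ suc) (U⊆X ∘ suc) w xw uw)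
... | true  | false = contradiction (trans (sym (U⊆X zero u0)) x0) λ ()
... | false | true  = m≤n⇒m≤1+n (card-< (U ∘ suc) (X ∘ suc) (U⊆X ∘ suc) w xw uw)
... | false | false = card-< (U ∘ suc) (X ∘ suc) (U⊆X ∘ suc) w xw uw

card-∪ : (U X : Fin n → Bool) → card (U ∪ X) ≤ card U + card X
card-∪ {zero}  U X = z≤n
card-∪ {suc n} U X with U zero | X zero | card-∪ (U ∘ suc) (X ∘ suc)
... | true  | true  | ih = s≤s (≤-trans ih (+-monoʳ-≤ (card (U ∘ suc)) (n≤1+n _)))
... | true  | false | ih = s≤s ih
... | false | true  | ih = subst (suc (card ((U ∪ X) ∘ suc)) ≤_) (sym (+-suc _ _)) (s≤s ih)
... | false | false | ih = ih

card-⊆-lookup : (U : Fin n → Bool) (W : Subset n) → U ⊆ lookup W → card U ≤ ∣ W ∣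
card-⊆-lookup U W U⊆W = subst (card U ≤_) (cong ∣_∣ (tabulate∘lookup W)) (card-mono U (lookup W) U⊆W)

card-∅ : card (∅ {n}) ≡ 0
card-∅ {zero}  = refl
card-∅ {suc n} = card-∅ {n}

card-⁅⁆ : (v : Fin n) → card ⁅ v ⁆ ≡ 1
card-⁅⁆ {suc n} zero    = cong suc (card-∅ {n})
card-⁅⁆ {suc n} (suc v) = card-⁅⁆ v

⋃ : {A : Set} → List A → (A → Fin n → Bool) → Fin n → Bool
⋃ []       X = ∅
⋃ (a ∷ as) X = X a ∪ ⋃ as X

⊆-⋃ : ∀ {A : Set} {a : A} {as} (X : A → Fin n → Bool) → a ∈ as → X a ⊆ ⋃ as X
⊆-⋃ {as = _ ∷ as} X (here refl) u Xu = cong (_∨ ⋃ as X u) Xu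
⊆-⋃ X (there a∈)  u Xu = trans (cong (X _ u ∨_) (⊆-⋃ X a∈ u Xu)) (∨-zeroʳ (X _ u))

card-⋃ : ∀ {A : Set} d K (as : List A) (X : A → Fin n → Bool) →
         (∀ a → a ∈ as → d * card (X a) ≤ K) → d * card (⋃ as X) ≤ length as * K
card-⋃ {n} d K []       X bound = ≤-reflexive (trans (cong (d *_) (card-∅ {n})) (*-zeroʳ d))
card-⋃     d K (a ∷ as) X bound = begin
  d * card (X a ∪ ⋃ as X)              ≤⟨ *-monoʳ-≤ d (card-∪ (X a) (⋃ as X)) ⟩
  d * (card (X a) + card (⋃ as X))     ≡⟨ *-distribˡ-+ d (card (X a)) (card (⋃ as X)) ⟩
  d * card (X a) + d * card (⋃ as X)   ≤⟨ +-mono-≤ (bound a (here refl))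
                                                     (card-⋃ d K as X (λ a' → bound a' ∘ there)) ⟩
  K + length as * K                    ∎
  where open ≤-Reasoning

¬¬-characteristic : (P : Fin n → Set) → ¬ ¬ Σ (Fin n → Bool) λ f → ∀ i → f i ≡ true ⇔ P i
¬¬-characteristic {zero}  P = pure ((λ ()) , λ ())
¬¬-characteristic {suc n} P = do
  (f , f⇔) ← ¬¬-characteristic (P ∘ suc)
  P₀? ← ¬¬-excluded-middle
  pure ((λ { zero → does P₀? ; (suc i) → f i }) , λ { zero → at-zero P₀? ; (suc i) → f⇔ i })
  where
  at-zero : (P₀? : Dec (P zero)) → does P₀? ≡ true ⇔ P zero
  at-zero (yes p) = mk⇔ (λ _ → p) (λ _ → refl)
  at-zero (no ¬p) = mk⇔ (λ ()) (λ p → contradiction p ¬p)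

∈-filterᵇ⁺ : ∀ {A : Set} (p : A → Bool) {x xs} → x ∈ xs → p x ≡ true → x ∈ filterᵇ p xs
∈-filterᵇ⁺ p x∈xs px = ∈-filter⁺ (T? ∘ p) x∈xs (Equivalence.from T-≡ px)

∈-filterᵇ⁻ : ∀ {A : Set} (p : A → Bool) {x} xs → x ∈ filterᵇ p xs → x ∈ xs × p x ≡ true
∈-filterᵇ⁻ p xs x∈ = map₂ (Equivalence.to T-≡) (∈-filter⁻ (T? ∘ p) x∈)

module _ {m : ℕ} where

  restrict : Assignment m → List (Fin m) → Term m
  restrict β = map (λ e → e , β e)

  branch : Fin m → Term m → List (Term m)
  branch e t = ((e , true) ∷ t) ∷ ((e , false) ∷ t) ∷ []

  restrict∈allTerms : ∀ β es → restrict β es ∈ allTerms es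
  restrict∈allTerms β []       = here refl
  restrict∈allTerms β (e ∷ es) =
    concatMap⁺ (branch e) (Any.map (λ { refl → pick (β e) }) (restrict∈allTerms β es))
    where
    pick : ∀ b → ((e , b) ∷ restrict β es) ∈ branch e (restrict β es)
    pick true  = here refl
    pick false = there (here refl)

  restrict-falsifies : ∀ β es → ¬ SatClause β (falsifiedBy (restrict β es))
  restrict-falsifies β (e ∷ es) (here βe≡¬βe) = not-¬ refl βe≡¬βe
  restrict-falsifies β (e ∷ es) (there sat)   = restrict-falsifies β es sat

  falsified⇒restrict : ∀ β es t → t ∈ allTerms es → ¬ SatClause β (falsifiedBy t) → t ≡ restrict β es
  falsified⇒restrict β []       t (here refl) _ = refl
  falsified⇒restrict β (e ∷ es) t t∈ unsat with find (concatMap⁻ (branch e) {xs = allTerms es} t∈)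
  ... | t' , t'∈ , here refl         =
    cong₂ _∷_ (cong (e ,_) (sym (¬-not (unsat ∘ here))))
              (falsified⇒restrict β es t' t'∈ (unsat ∘ there))
  ... | t' , t'∈ , there (here refl) =
    cong₂ _∷_ (cong (e ,_) (sym (¬-not (unsat ∘ here))))
              (falsified⇒restrict β es t' t'∈ (unsat ∘ there))

  allTerms-edges : ∀ es t l → t ∈ allTerms es → l ∈ t → proj₁ l ∈ es
  allTerms-edges []       _ l (here refl) ()
  allTerms-edges (e ∷ es) t l t∈ l∈ with find (concatMap⁻ (branch e) {xs = allTerms es} t∈)
  allTerms-edges (e ∷ es) _ l _ (here refl) | t' , t'∈ , here refl         = here refl
  allTerms-edges (e ∷ es) _ l _ (there l∈)  | t' , t'∈ , here refl         = there (allTerms-edges es t' l t'∈ l∈)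
  allTerms-edges (e ∷ es) _ l _ (here refl) | t' , t'∈ , there (here refl) = here refl
  allTerms-edges (e ∷ es) _ l _ (there l∈)  | t' , t'∈ , there (here refl) = there (allTerms-edges es t' l t'∈ l∈)

  parityᵗ-restrict-filter : ∀ {k} (h : Fin k → Fin m) (p β : Fin m → Bool) →
    parityᵗ (restrict β (filterᵇ p (tabulateL h))) ≡ ⨁ (λ i → p (h i) ∧ β (h i))
  parityᵗ-restrict-filter {zero}  h p β = refl
  parityᵗ-restrict-filter {suc k} h p β with p (h zero)
  ... | true  = cong (β (h zero) xor_) (parityᵗ-restrict-filter (h ∘ suc) p β)
  ... | false = parityᵗ-restrict-filter (h ∘ suc) p β

  AgreeOff : (Fin m → Bool) → Assignment m → Assignment m → Set
  AgreeOff φ γ β = ∀ e → φ e ≡ false → γ e ≡ β e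

  mentions : Term m → Fin m → Bool
  mentions []      e = false
  mentions (l ∷ T) e = does (proj₁ l ≟ e) ∨ mentions T e

  free : Term m → Fin m → Bool
  free T e = not (mentions T e)

  sat⇒agreeOff : ∀ {α γ} T → SatTerm α T → SatTerm γ T → AgreeOff (free T) γ α
  sat⇒agreeOff (l ∷ T) (αl ∷ αT) (γl ∷ γT) e fr with proj₁ l ≟ e
  ... | yes refl = trans γl (sym αl)
  ... | no _     = sat⇒agreeOff T αT γT e fr

  agreeOff⇒sat : ∀ {α γ} T → SatTerm α T → AgreeOff (free T) γ α → SatTerm γ T
  agreeOff⇒sat []      []        agree = []
  agreeOff⇒sat (l ∷ T) (αl ∷ αT) agree = trans (agree (proj₁ l) l-fixed) αl ∷ agreeOff⇒sat T αT agree-T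
    where
    l-fixed : free (l ∷ T) (proj₁ l) ≡ false
    l-fixed = cong (λ b → not (b ∨ mentions T (proj₁ l))) (dec-true (proj₁ l ≟ proj₁ l) refl)
    agree-T : AgreeOff (free T) _ _
    agree-T e fr = agree e (cong not (trans (cong (does (proj₁ l ≟ e) ∨_) (not-injective fr)) (∨-zeroʳ _)))

  agree⇒sat-restrict : ∀ {γ β} es → (∀ e → e ∈ es → γ e ≡ β e) → SatTerm γ (restrict β es)
  agree⇒sat-restrict []       agree = []
  agree⇒sat-restrict (e ∷ es) agree = agree e (here refl) ∷ agree⇒sat-restrict es (λ e' → agree e' ∘ there)

  sat-restrict⇒agree : ∀ {γ β} es → SatTerm γ (restrict β es) → ∀ e → e ∈ es → γ e ≡ β e
  sat-restrict⇒agree (e ∷ es) (γe ∷ _)  e (here refl) = γe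
  sat-restrict⇒agree (_ ∷ es) (_ ∷ sat) e (there e∈) = sat-restrict⇒agree es sat e e∈

module Tseitin {n m : ℕ} (G : Graph n m) (χ : Fin n → Bool) where

  end₁ end₂ : Fin m → Fin n
  end₁ e = proj₁ (ends G e)
  end₂ e = proj₂ (ends G e)

  -- loops are excluded, so "end₁ e = u or end₂ e = u" is an exclusive or
  incidentᵇ-xor : ∀ u e → incidentᵇ G u e ≡ does (end₁ e ≟ u) xor does (end₂ e ≟ u)
  incidentᵇ-xor u e with end₁ e ≟ u | end₂ e ≟ u
  ... | yes p | yes q = contradiction (trans p (sym q)) (loopless G e)
  ... | yes _ | no _  = refl
  ... | no _  | yes _ = refl
  ... | no _  | no _  = refl

  incidentᵇ-end₁ : ∀ e → incidentᵇ G (end₁ e) e ≡ true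
  incidentᵇ-end₁ e = cong (_∨ does (end₂ e ≟ end₁ e)) (dec-true (end₁ e ≟ end₁ e) refl)

  incidentᵇ-end₂ : ∀ e → incidentᵇ G (end₂ e) e ≡ true
  incidentᵇ-end₂ e = trans (cong (does (end₁ e ≟ end₂ e) ∨_) (dec-true (end₂ e ≟ end₂ e) refl))
                           (∨-zeroʳ (does (end₁ e ≟ end₂ e)))

  incidentᵇ-≢ : ∀ {u} e → u ≢ end₁ e → u ≢ end₂ e → incidentᵇ G u e ≡ false
  incidentᵇ-≢ e u≢₁ u≢₂ =
    cong₂ _∨_ (dec-false (end₁ e ≟ _) (≢-sym u≢₁)) (dec-false (end₂ e ≟ _) (≢-sym u≢₂))

  incident-end : ∀ {v e} → incidentᵇ G v e ≡ true → end₁ e ≡ v ⊎ end₂ e ≡ v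
  incident-end {v} {e} ve with end₁ e ≟ v | end₂ e ≟ v
  ... | yes p | _     = inj₁ p
  ... | no  _ | yes q = inj₂ q

  parityAt : Assignment m → Fin n → Bool
  parityAt β u = ⨁ (λ e → incidentᵇ G u e ∧ β e)

  violated : Assignment m → Fin n → Bool
  violated β u = parityAt β u xor χ u

  charge : Assignment m → (Fin n → Bool) → Bool
  charge β U = ⨁ (λ u → U u ∧ violated β u)

  ∂ : (Fin n → Bool) → Fin m → Bool
  ∂ U e = U (end₁ e) xor U (end₂ e)

  ⨁-incident : ∀ (U : Fin n → Bool) e → ⨁ (λ u → incidentᵇ G u e ∧ U u) ≡ ∂ U e
  ⨁-incident U e = begin
    ⨁ (λ u → incidentᵇ G u e ∧ U u)
      ≡⟨ ⨁-cong (λ u → trans (cong (_∧ U u) (incidentᵇ-xor u e))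
                             (∧-distribʳ-xor (U u) (does (end₁ e ≟ u)) (does (end₂ e ≟ u)))) ⟩
    ⨁ (λ u → (does (end₁ e ≟ u) ∧ U u) xor (does (end₂ e ≟ u) ∧ U u))
      ≡⟨ ⨁-xor (λ u → does (end₁ e ≟ u) ∧ U u) (λ u → does (end₂ e ≟ u) ∧ U u) ⟩
    ⨁ (λ u → does (end₁ e ≟ u) ∧ U u) xor ⨁ (λ u → does (end₂ e ≟ u) ∧ U u)
      ≡⟨ cong₂ _xor_ (⨁-δ (end₁ e) U) (⨁-δ (end₂ e) U) ⟩
    ∂ U e ∎
    where open ≡-Reasoning

  -- an edge inside U contributes to the parity at both of its ends, so only boundary edges survive
  charge-∂ : ∀ β U → charge β U ≡ ⨁ (λ e → β e ∧ ∂ U e) xor ⨁ (λ u → U u ∧ χ u)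
  charge-∂ β U = begin
    ⨁ (λ u → U u ∧ (parityAt β u xor χ u))
      ≡⟨ ⨁-cong (λ u → ∧-distribˡ-xor (U u) (parityAt β u) (χ u)) ⟩
    ⨁ (λ u → (U u ∧ parityAt β u) xor (U u ∧ χ u))
      ≡⟨ ⨁-xor (λ u → U u ∧ parityAt β u) (λ u → U u ∧ χ u) ⟩
    ⨁ (λ u → U u ∧ parityAt β u) xor ⨁ (λ u → U u ∧ χ u)
      ≡⟨ cong (_xor ⨁ (λ u → U u ∧ χ u)) parity-part ⟩
    ⨁ (λ e → β e ∧ ∂ U e) xor ⨁ (λ u → U u ∧ χ u) ∎
    where
    open ≡-Reasoning
    rearrange : ∀ x y z → x ∧ (y ∧ z) ≡ z ∧ (y ∧ x)
    rearrange x y z = trans (sym (∧-assoc x y z)) (trans (∧-comm (x ∧ y) z) (cong (z ∧_) (∧-comm x y)))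
    parity-part : ⨁ (λ u → U u ∧ parityAt β u) ≡ ⨁ (λ e → β e ∧ ∂ U e)
    parity-part = begin
      ⨁ (λ u → U u ∧ parityAt β u)
        ≡⟨ ⨁-cong (λ u → sym (⨁-∧ˡ (U u) (λ e → incidentᵇ G u e ∧ β e))) ⟩
      ⨁ (λ u → ⨁ (λ e → U u ∧ (incidentᵇ G u e ∧ β e)))
        ≡⟨ ⨁-swap (λ u e → U u ∧ (incidentᵇ G u e ∧ β e)) ⟩
      ⨁ (λ e → ⨁ (λ u → U u ∧ (incidentᵇ G u e ∧ β e)))
        ≡⟨ ⨁-cong (λ e → trans (⨁-cong (λ u → rearrange (U u) _ (β e)))
                               (⨁-∧ˡ (β e) (λ u → incidentᵇ G u e ∧ U u))) ⟩
      ⨁ (λ e → β e ∧ ⨁ (λ u → incidentᵇ G u e ∧ U u))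
        ≡⟨ ⨁-cong (λ e → cong (β e ∧_) (⨁-incident U e)) ⟩
      ⨁ (λ e → β e ∧ ∂ U e) ∎

  charge-cong-∂ : ∀ α β U → (∀ e → ∂ U e ≡ true → α e ≡ β e) → charge α U ≡ charge β U
  charge-cong-∂ α β U agree = begin
    charge α U                                              ≡⟨ charge-∂ α U ⟩
    ⨁ (λ e → α e ∧ ∂ U e) xor ⨁ (λ u → U u ∧ χ u)          ≡⟨ cong (_xor _) (⨁-cong same) ⟩
    ⨁ (λ e → β e ∧ ∂ U e) xor ⨁ (λ u → U u ∧ χ u)          ≡⟨ sym (charge-∂ β U) ⟩
    charge β U ∎
    where
    open ≡-Reasoning
    same : ∀ e → α e ∧ ∂ U e ≡ β e ∧ ∂ U e
    same e with ∂ U e in ∂e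
    ... | true  = cong (_∧ true) (agree e ∂e)
    ... | false = trans (∧-zeroʳ (α e)) (sym (∧-zeroʳ (β e)))

  toggle : Assignment m → Fin m → Assignment m
  toggle β e x = β x xor does (e ≟ x)

  toggle-≢ : ∀ β {e e'} → e' ≢ e → toggle β e e' ≡ β e'
  toggle-≢ β {e} {e'} e'≢e =
    trans (cong (β e' xor_) (dec-false (e ≟ e') (≢-sym e'≢e))) (xor-identityʳ (β e'))

  violated-toggle : ∀ β e u → violated (toggle β e) u ≡ violated β u xor incidentᵇ G u e
  violated-toggle β e u = begin
    ⨁ (λ x → incidentᵇ G u x ∧ (β x xor does (e ≟ x))) xor χ u
      ≡⟨ cong (_xor χ u) (⨁-cong (λ x → ∧-distribˡ-xor (incidentᵇ G u x) (β x) (does (e ≟ x)))) ⟩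
    ⨁ (λ x → (incidentᵇ G u x ∧ β x) xor (incidentᵇ G u x ∧ does (e ≟ x))) xor χ u
      ≡⟨ cong (_xor χ u) (⨁-xor (λ x → incidentᵇ G u x ∧ β x)
                                (λ x → incidentᵇ G u x ∧ does (e ≟ x))) ⟩
    (parityAt β u xor ⨁ (λ x → incidentᵇ G u x ∧ does (e ≟ x))) xor χ u
      ≡⟨ cong (λ b → (parityAt β u xor b) xor χ u) δ-part ⟩
    (parityAt β u xor incidentᵇ G u e) xor χ u
      ≡⟨ xy∙z≈xz∙y (parityAt β u) (incidentᵇ G u e) (χ u) ⟩
    violated β u xor incidentᵇ G u e ∎
    where
    open ≡-Reasoning
    δ-part : ⨁ (λ x → incidentᵇ G u x ∧ does (e ≟ x)) ≡ incidentᵇ G u e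
    δ-part = trans (⨁-cong (λ x → ∧-comm (incidentᵇ G u x) (does (e ≟ x)))) (⨁-δ e (incidentᵇ G u))

  charge-toggle : ∀ β e U → charge (toggle β e) U ≡ charge β U xor ∂ U e
  charge-toggle β e U = begin
    ⨁ (λ u → U u ∧ violated (toggle β e) u)
      ≡⟨ ⨁-cong (λ u → trans (cong (U u ∧_) (violated-toggle β e u))
                             (∧-distribˡ-xor (U u) (violated β u) (incidentᵇ G u e))) ⟩
    ⨁ (λ u → (U u ∧ violated β u) xor (U u ∧ incidentᵇ G u e))
      ≡⟨ ⨁-xor (λ u → U u ∧ violated β u) (λ u → U u ∧ incidentᵇ G u e) ⟩
    charge β U xor ⨁ (λ u → U u ∧ incidentᵇ G u e)
      ≡⟨ cong (charge β U xor_)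
              (trans (⨁-cong (λ u → ∧-comm (U u) (incidentᵇ G u e))) (⨁-incident U e)) ⟩
    charge β U xor ∂ U e ∎
    where open ≡-Reasoning

  charge-⁅⁆ : ∀ β u → charge β ⁅ u ⁆ ≡ violated β u
  charge-⁅⁆ β u = ⨁-δ u (violated β)

  charge-cong : ∀ β {U X : Fin n → Bool} → (∀ u → U u ≡ X u) → charge β U ≡ charge β X
  charge-cong β U≗X = ⨁-cong (λ u → cong (_∧ violated β u) (U≗X u))

  charge-△ : ∀ β U X → charge β (U △ X) ≡ charge β U xor charge β X
  charge-△ β U X =
    trans (⨁-cong (λ u → ∧-distribʳ-xor (violated β u) (U u) (X u)))
          (⨁-xor (λ u → U u ∧ violated β u) (λ u → X u ∧ violated β u))

  charge-split : ∀ β U Y → charge β U ≡ charge β (U ∩ Y) xor charge β (U ─ Y)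
  charge-split β U Y = trans (charge-cong β split) (charge-△ β (U ∩ Y) (U ─ Y))
    where
    split : ∀ u → U u ≡ ((U ∩ Y) △ (U ─ Y)) u
    split u with U u | Y u
    ... | true  | true  = refl
    ... | true  | false = refl
    ... | false | _     = refl

  charge-satisfied : ∀ β U → (∀ u → U u ≡ true → violated β u ≡ false) → charge β U ≡ false
  charge-satisfied β U sat = ⨁-zero _ pointwise
    where
    pointwise : ∀ u → U u ∧ violated β u ≡ false
    pointwise u with U u in Uu
    ... | true  = sat u Uu
    ... | false = refl

  charge-violated : ∀ β U → charge β U ≡ true → ∃ λ u → U u ≡ true × violated β u ≡ true
  charge-violated β U odd with ⨁≡true⇒∃ (λ u → U u ∧ violated β u) odd
  ... | u , U∧v with U u in Uu | violated β u in vu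
  ...   | true | true = u , Uu , vu

  ∈-incident⁻ : ∀ {v e} → e ∈ incident G v → incidentᵇ G v e ≡ true
  ∈-incident⁻ {v} e∈ = proj₂ (∈-filterᵇ⁻ (incidentᵇ G v) (allFin m) e∈)

  ∈-incident⁺ : ∀ {v e} → incidentᵇ G v e ≡ true → e ∈ incident G v
  ∈-incident⁺ {v} {e} ve = ∈-filterᵇ⁺ (incidentᵇ G v) (∈-allFin e) ve

  violatesᵗ : Fin n → Term m → Bool
  violatesᵗ v t = parityᵗ t xor χ v

  parityᵗ-incident : ∀ β u → parityᵗ (restrict β (incident G u)) ≡ parityAt β u
  parityᵗ-incident β u = parityᵗ-restrict-filter (λ e → e) (incidentᵇ G u) β

  sat-PARITY⇒satisfied : ∀ α v → SatCNF α (PARITY G χ v) → violated α v ≡ false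
  sat-PARITY⇒satisfied α v sat with violated α v in viol
  ... | false = refl
  ... | true  = contradiction (All.lookup sat (∈-map⁺ falsifiedBy violating∈)) (restrict-falsifies α es)
    where
    es = incident G v
    violating∈ : restrict α es ∈ filterᵇ (violatesᵗ v) (allTerms es)
    violating∈ = ∈-filterᵇ⁺ _ (restrict∈allTerms α es)
                   (trans (cong (_xor χ v) (parityᵗ-incident α v)) viol)

  satisfied⇒sat-PARITY : ∀ α v → violated α v ≡ false → SatCNF α (PARITY G χ v)
  satisfied⇒sat-PARITY α v sat = All.tabulate clause-sat
    where
    es = incident G v
    clause-sat : ∀ {C} → C ∈ PARITY G χ v → SatClause α C
    clause-sat C∈ with ∈-map⁻ falsifiedBy C∈
    ... | t , t∈ , refl with ∈-filterᵇ⁻ (violatesᵗ v) (allTerms es) t∈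
    ... | t∈allTerms , t-violates with Any.any? (λ l → α (proj₁ l) Bool.≟ proj₂ l) (falsifiedBy t)
    ...   | yes satC = satC
    ...   | no unsat = contradiction (trans (sym t-violates) violation) λ ()
      where
      violation : parityᵗ t xor χ v ≡ false
      violation = begin
        parityᵗ t xor χ v                         ≡⟨ cong (λ t → parityᵗ t xor χ v)
                                                       (falsified⇒restrict α es t t∈allTerms unsat) ⟩
        parityᵗ (restrict α es) xor χ v           ≡⟨ cong (_xor χ v) (parityᵗ-incident α v) ⟩
        violated α v                              ≡⟨ sat ⟩
        false ∎
        where open ≡-Reasoning

  PARITY-edges : ∀ {v C l} → C ∈ PARITY G χ v → l ∈ C → proj₁ l ∈ incident G v
  PARITY-edges {v} C∈ l∈ with ∈-map⁻ falsifiedBy C∈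
  ... | t , t∈ , refl with ∈-map⁻ _ l∈
  ...   | l' , l'∈ , refl =
    allTerms-edges (incident G v) t l' (proj₁ (∈-filterᵇ⁻ (violatesᵗ v) (allTerms (incident G v)) t∈)) l'∈

  SatClause-PARITY : ∀ {v C} β γ → C ∈ PARITY G χ v → SatClause β C →
                     (∀ e → e ∈ incident G v → γ e ≡ β e) → SatClause γ C
  SatClause-PARITY β γ C∈ satC agree with find satC
  ... | l , l∈ , βl = lose l∈ (trans (agree (proj₁ l) (PARITY-edges C∈ l∈)) βl)

  Closed : (Fin m → Bool) → (Fin n → Bool) → Set
  Closed φ U = ∀ e → φ e ≡ true → U (end₁ e) ≡ U (end₂ e)

  closed-∩ : ∀ {φ} U X → Closed φ U → Closed φ X → Closed φ (U ∩ X)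
  closed-∩ U X closedU closedX e φe = cong₂ _∧_ (closedU e φe) (closedX e φe)

  closed-─ : ∀ {φ} U X → Closed φ U → Closed φ X → Closed φ (U ─ X)
  closed-─ U X closedU closedX e φe = cong₂ (λ a b → a ∧ not b) (closedU e φe) (closedX e φe)

  closed-∪ : ∀ {φ} U X → Closed φ U → Closed φ X → Closed φ (U ∪ X)
  closed-∪ U X closedU closedX e φe = cong₂ _∨_ (closedU e φe) (closedX e φe)

  closed-⋃ : ∀ {A : Set} {φ} (as : List A) (X : A → Fin n → Bool) →
             (∀ a → a ∈ as → Closed φ (X a)) → Closed φ (⋃ as X)
  closed-⋃ []       X closed e φe = refl
  closed-⋃ (a ∷ as) X closed =
    closed-∪ (X a) (⋃ as X) (closed a (here refl)) (closed-⋃ as X (λ a' → closed a' ∘ there))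

  ∂≡true⇒free : ∀ {φ} U → Closed φ U → ∀ e → ∂ U e ≡ true → φ e ≡ false
  ∂≡true⇒free {φ} U closed e ∂e with φ e in φe
  ... | false = refl
  ... | true  = contradiction (trans (sym ∂e) ∂≡false) λ ()
    where ∂≡false = trans (cong (_xor U (end₂ e)) (closed e φe)) (xor-same (U (end₂ e)))

  ClosedOn : List (Fin m) → (Fin n → Bool) → Set
  ClosedOn L U = All (λ e → U (end₁ e) ≡ U (end₂ e)) L

  ∂≡false⇒closed : ∀ U e → ∂ U e ≡ false → U (end₁ e) ≡ U (end₂ e)
  ∂≡false⇒closed U e = xor≡false⇒≡ (U (end₁ e)) (U (end₂ e))

  ∂-△ : ∀ U X e → ∂ (U △ X) e ≡ ∂ U e xor ∂ X e
  ∂-△ U X e = interchange (U (end₁ e)) (X (end₁ e)) (U (end₂ e)) (X (end₂ e))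

  OddOn : List (Fin m) → Assignment m → (Fin n → Bool) → Set
  OddOn L β W = Σ (Fin n → Bool) λ U → U ⊆ W × ClosedOn L U × charge β U ≡ true

  Repair : List (Fin m) → Assignment m → (Fin n → Bool) → Set
  Repair L β W = Σ (Assignment m) λ γ →
    (∀ e → e ∉ L → γ e ≡ β e) × (∀ u → W u ≡ true → violated γ u ≡ false)

  odd-shrink : ∀ e L β {V W} → V ⊆ W → V (end₁ e) ≡ false → V (end₂ e) ≡ false →
               OddOn L β V → OddOn (e ∷ L) β W
  odd-shrink e L β V⊆W V₁ V₂ (U , U⊆V , closed , odd) =
    U , (λ u → V⊆W u ∘ U⊆V u) , trans (⊆-false U⊆V V₁) (sym (⊆-false U⊆V V₂)) ∷ closed , odd

  -- odd sets not already closed on e ∷ L cross e, and then their symmetric difference does not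
  odd-△ : ∀ e L β W → OddOn L β W → OddOn L (toggle β e) W → OddOn (e ∷ L) β W
  odd-△ e L β W (U , U⊆W , closedU , oddU) (X , X⊆W , closedX , oddX) with ∂ U e in ∂U | ∂ X e in ∂X
  ... | false | _     = U , U⊆W , ∂≡false⇒closed U e ∂U ∷ closedU , oddU
  ... | true  | false = X , X⊆W , ∂≡false⇒closed X e ∂X ∷ closedX , oddX'
    where
    oddX' : charge β X ≡ true
    oddX' = begin
      charge β X                   ≡⟨ sym (xor-identityʳ _) ⟩
      charge β X xor false         ≡⟨ cong (charge β X xor_) (sym ∂X) ⟩
      charge β X xor ∂ X e         ≡⟨ sym (charge-toggle β e X) ⟩
      charge (toggle β e) X        ≡⟨ oddX ⟩
      true ∎
      where open ≡-Reasoning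
  ... | true  | true  =
    U △ X , △⊆ , ∂≡false⇒closed (U △ X) e (trans (∂-△ U X e) (cong₂ _xor_ ∂U ∂X))
               ∷ All.zipWith (λ (p , q) → cong₂ _xor_ p q) (closedU , closedX) ,
    trans (charge-△ β U X) (cong₂ _xor_ oddU evenX)
    where
    △⊆ : U △ X ⊆ W
    △⊆ u U△Xu with U u in Uu
    ... | true  = U⊆W u Uu
    ... | false = X⊆W u U△Xu
    evenX : charge β X ≡ false
    evenX with charge β X | trans (sym (charge-toggle β e X)) oddX
    ... | false | _ = refl
    ... | true  | toggled rewrite ∂X = contradiction toggled λ ()

  repair-[] : ∀ β W → ¬ OddOn [] β W → Repair [] β W
  repair-[] β W even = β , (λ _ _ → refl) , satisfied
    where
    satisfied : ∀ u → W u ≡ true → violated β u ≡ false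
    satisfied u Wu = trans (sym (charge-⁅⁆ β u)) (¬-not (λ odd → even (⁅ u ⁆ , ⁅⁆⊆ Wu , [] , odd)))

  repair-∷ : ∀ e L β W → Repair L β W → Repair (e ∷ L) β W
  repair-∷ e L β W (γ , agree , sat) = γ , (λ e' e'∉ → agree e' (e'∉ ∘ there)) , sat

  -- fix the other vertices of W first, then toggle e if x is still violated
  repair-end : ∀ e L β W x → W x ≡ true → incidentᵇ G x e ≡ true →
    (∀ u → W u ≡ true → u ≢ x → incidentᵇ G u e ≡ false) →
    Repair L β (W ─ ⁅ x ⁆) → Repair (e ∷ L) β W
  repair-end e L β W x Wx xe others (γ , agree , sat) with violated γ x in γx
  ... | false = γ , proj₁ (proj₂ (repair-∷ e L β _ (γ , agree , sat))) , sat'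
    where
    sat' : ∀ u → W u ≡ true → violated γ u ≡ false
    sat' u Wu with u ≟ x
    ... | yes refl = γx
    ... | no  u≢x  = sat u (∈─⁅⁆ {W = W} Wu u≢x)
  ... | true  = toggle γ e , agree' , sat'
    where
    agree' : ∀ e' → e' ∉ e ∷ L → toggle γ e e' ≡ β e'
    agree' e' e'∉ = trans (toggle-≢ γ (e'∉ ∘ here)) (agree e' (e'∉ ∘ there))
    sat' : ∀ u → W u ≡ true → violated (toggle γ e) u ≡ false
    sat' u Wu with u ≟ x
    ... | yes refl = trans (violated-toggle γ e u) (cong₂ _xor_ γx xe)
    ... | no  u≢x  = trans (violated-toggle γ e u)
                           (cong₂ _xor_ (sat u (∈─⁅⁆ {W = W} Wu u≢x)) (others u Wu u≢x))

  even⇒repair : ∀ L β W → ¬ OddOn L β W → ¬ ¬ Repair L β W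
  even⇒repair []      β W even = pure (repair-[] β W even)
  even⇒repair (e ∷ L) β W even with W (end₁ e) in W₁ | W (end₂ e) in W₂
  ... | false | false =
    repair-∷ e L β W <$> even⇒repair L β W (even ∘ odd-shrink e L β (λ _ → id) W₁ W₂)
  ... | true  | false =
    repair-end e L β W (end₁ e) W₁ (incidentᵇ-end₁ e) others <$> even⇒repair L β (W ─ ⁅ end₁ e ⁆)
      (even ∘ odd-shrink e L β (─⊆ W ⁅ end₁ e ⁆) (─⁅⁆-∉ W) (─-∉ {W = W} ⁅ end₁ e ⁆ W₂))
    where
    others : ∀ u → W u ≡ true → u ≢ end₁ e → incidentᵇ G u e ≡ false
    others u Wu u≢₁ = incidentᵇ-≢ e u≢₁ (λ { refl → contradiction (trans (sym Wu) W₂) λ () })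
  ... | false | true  =
    repair-end e L β W (end₂ e) W₂ (incidentᵇ-end₂ e) others <$> even⇒repair L β (W ─ ⁅ end₂ e ⁆)
      (even ∘ odd-shrink e L β (─⊆ W ⁅ end₂ e ⁆) (─-∉ {W = W} ⁅ end₂ e ⁆ W₁) (─⁅⁆-∉ W))
    where
    others : ∀ u → W u ≡ true → u ≢ end₂ e → incidentᵇ G u e ≡ false
    others u Wu u≢₂ = incidentᵇ-≢ e (λ { refl → contradiction (trans (sym Wu) W₁) λ () }) u≢₂
  ... | true  | true  = do
    no ¬odd ← ¬¬-excluded-middle {A = OddOn L β W}
      where yes odd → do
        no ¬odd' ← ¬¬-excluded-middle {A = OddOn L (toggle β e) W}
          where yes odd' → contradiction (odd-△ e L β W odd odd') even
        (γ , agree , sat) ← even⇒repair L (toggle β e) W ¬odd'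
        pure (γ , agree-untoggle γ agree , sat)
    repair-∷ e L β W <$> even⇒repair L β W ¬odd
    where
    agree-untoggle : ∀ γ → (∀ e' → e' ∉ L → γ e' ≡ toggle β e e') →
                     ∀ e' → e' ∉ e ∷ L → γ e' ≡ β e'
    agree-untoggle γ agree e' e'∉ = trans (agree e' (e'∉ ∘ there)) (toggle-≢ β (e'∉ ∘ here))

  Odd : (Fin m → Bool) → Assignment m → (Fin n → Bool) → Set
  Odd φ β W = Σ (Fin n → Bool) λ U → U ⊆ W × Closed φ U × charge β U ≡ true

  even⇒satisfiable : ∀ φ β W → ¬ Odd φ β W →
    ¬ ¬ Σ (Assignment m) λ γ → AgreeOff φ γ β × (∀ u → W u ≡ true → violated γ u ≡ false)
  even⇒satisfiable φ β W even = do
    (γ , agree , sat) ← even⇒repair L β W (λ (U , U⊆W , closed , odd) → even (U , U⊆W , closed-L U closed , odd))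
    pure (γ , (λ e φe → agree e (∉L φe)) , sat)
    where
    L = filterᵇ φ (allFin m)
    closed-L : ∀ U → ClosedOn L U → Closed φ U
    closed-L U closed e φe = All.lookup closed (∈-filterᵇ⁺ φ (∈-allFin e) φe)
    ∉L : ∀ {e} → φ e ≡ false → e ∉ L
    ∉L φe e∈ = contradiction (trans (sym φe) (proj₂ (∈-filterᵇ⁻ φ (allFin m) e∈))) λ ()

  -- U = (U ∩ Y) △ (U ─ Y) with both parts closed, so an odd U that contains a point
  -- of Y and has U ∩ Y too small to be odd leaves a strictly smaller odd set U ─ Y
  no-odd-by-descent : ∀ φ β W k →
    (∀ U → Closed φ U → charge β U ≡ true → k ≤ card U) →
    (∀ U → U ⊆ W → Closed φ U → charge β U ≡ true →
       Σ (Fin n → Bool) λ Y → Closed φ Y × (∃ λ u → U u ≡ true × Y u ≡ true) × card (U ∩ Y) < k) →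
    ¬ Odd φ β W
  no-odd-by-descent φ β W k large cover (U , U⊆W , closed , odd) = go (card U) U ≤-refl U⊆W closed odd
    where
    go : ∀ s U → card U ≤ s → U ⊆ W → Closed φ U → charge β U ≡ true → ⊥
    go s U U≤s U⊆W closedU oddU with cover U U⊆W closedU oddU
    ... | Y , closedY , (w , Uw , Yw) , small = descend s (≤-trans shrinks U≤s)
      where
      ∩-even : charge β (U ∩ Y) ≡ false
      ∩-even = ¬-not (λ odd∩ → <⇒≱ small (large (U ∩ Y) (closed-∩ U Y closedU closedY) odd∩))
      ─-odd : charge β (U ─ Y) ≡ true
      ─-odd = trans (sym (cong (_xor charge β (U ─ Y)) ∩-even)) (trans (sym (charge-split β U Y)) oddU)
      shrinks : card (U ─ Y) < card U
      shrinks = card-< (U ─ Y) U (─⊆ U Y) w Uw (trans (cong (λ b → U w ∧ not b) Yw) (∧-zeroʳ (U w)))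
      descend : ∀ s → card (U ─ Y) < s → ⊥
      descend (suc s) (s≤s ─≤s) =
        go s (U ─ Y) ─≤s (λ u → U⊆W u ∘ ─⊆ U Y u) (closed-─ U Y closedU closedY) ─-odd

  -- the boundary edges of U are fixed by T, and the charge vanishes once every vertex of U is satisfied
  odd⇒refutes : ∀ {T φ β U} → (∀ γ → SatTerm γ T → AgreeOff φ γ β) → Closed φ U → charge β U ≡ true →
                RefutedBy G χ T (tabulate U)
  odd⇒refutes {T} {φ} {β} {U} forces closed odd γ γT γPARITY =
    contradiction (trans (sym odd) (trans same-charge (charge-satisfied γ U satisfied))) λ ()
    where
    same-charge : charge β U ≡ charge γ U
    same-charge = charge-cong-∂ β γ U (λ e ∂e → sym (forces γ γT e (∂≡true⇒free U closed e ∂e)))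
    satisfied : ∀ u → U u ≡ true → violated γ u ≡ false
    satisfied u Uu = sat-PARITY⇒satisfied γ u (γPARITY u (∈-tabulate U Uu))

  refutes⇒odd : ∀ {T φ β} W → (∀ γ → AgreeOff φ γ β → SatTerm γ T) → RefutedBy G χ T W →
                ¬ ¬ Odd φ β (lookup W)
  refutes⇒odd {φ = φ} {β} W allows refuted = do
    no even ← ¬¬-excluded-middle
      where yes odd → pure odd
    (γ , agree , sat) ← even⇒satisfiable φ β (lookup W) even
    ⊥-elim (refuted γ (allows γ agree) (λ u u∈ → satisfied⇒sat-PARITY γ u (sat u ([]=⇒lookup u∈))))

  termMeasure-exists : ∀ T W → RefutedBy G χ T W → ¬ ¬ Σ ℕ (IsTermMeasure G χ T)
  termMeasure-exists T W = go ∣ W ∣ W ≤-refl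
    where
    go : ∀ s W → ∣ W ∣ ≤ s → RefutedBy G χ T W → ¬ ¬ Σ ℕ (IsTermMeasure G χ T)
    go s W W≤s refuted = do
      yes (W' , W'<W , refuted') ←
          ¬¬-excluded-middle {A = Σ (Subset n) λ W' → ∣ W' ∣ < ∣ W ∣ × RefutedBy G χ T W'}
        where no minimal →
                pure (∣ W ∣ , (W , refl , refuted) , λ W' r → ≮⇒≥ (λ lt → minimal (W' , lt , r)))
      descend s (≤-trans W'<W W≤s) refuted'
      where
      descend : ∀ s {W'} → suc ∣ W' ∣ ≤ s → RefutedBy G χ T W' → ¬ ¬ Σ ℕ (IsTermMeasure G χ T)
      descend (suc s) (s≤s W'≤s) = go s _ W'≤s

  termMeasure≤1 : ∀ {T v C k} → C ∈ PARITY G χ v → (∀ α → SatTerm α T → ¬ SatClause α C) →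
                  IsTermMeasure G χ T k → k ≤ 1
  termMeasure≤1 {T} {v} {C} {k} C∈ T⊭C μT =
    subst (k ≤_) (card-⁅⁆ v) (proj₂ μT (tabulate ⁅ v ⁆) refuted)
    where
    refuted : RefutedBy G χ T (tabulate ⁅ v ⁆)
    refuted α αT αPARITY =
      T⊭C α αT (All.lookup (αPARITY v (∈-tabulate ⁅ v ⁆ (dec-true (v ≟ v) refl))) C∈)

module Bound {n m : ℕ} (G : Graph n m) (χ : Fin n → Bool) (d : ℕ) (maxdeg : MaxDegreeAtMost G d)
  (v : Fin n) (A : Clause m) (A∈ : A ∈ PARITY G χ v) (C : CNF m) (k' : ℕ) (μ' : IsMeasure G χ (A ∷ C) k')
  (K : ℕ) (T : Term m) (T⊨C : T ⊨ C) (μT : IsTermMeasure G χ T (suc (suc K)))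
  (α₀ : Assignment m) (α₀T : SatTerm α₀ T) (α₀A : SatClause α₀ A) where

  open Tseitin G χ

  φ φ' : Fin m → Bool
  φ = free T
  φ' e = φ e ∧ not (incidentᵇ G v e)

  T' : Assignment m → Term m
  T' β = T ++ restrict β (incident G v)

  instance
    d-nonZero : NonZero d
    d-nonZero with find α₀A
    ... | l , l∈ , _ = >-nonZero (≤-trans (∈-length (PARITY-edges A∈ l∈)) (maxdeg v))

  odd⇒large : ∀ U → Closed φ U → charge α₀ U ≡ true → suc (suc K) ≤ card U
  odd⇒large U closed odd =
    proj₂ μT (tabulate U) (odd⇒refutes {T = T} (λ γ γT → sat⇒agreeOff T α₀T γT) closed odd)

  allows-T' : ∀ β → SatTerm β T → ∀ γ → AgreeOff φ' γ β → SatTerm γ (T' β)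
  allows-T' β βT γ agree =
    ++⁺ (agreeOff⇒sat T βT (λ e φe → agree e (cong (_∧ not (incidentᵇ G v e)) φe)))
        (agree⇒sat-restrict (incident G v) (λ e e∈ → agree e (at-v e (∈-incident⁻ e∈))))
    where
    at-v : ∀ e → incidentᵇ G v e ≡ true → φ' e ≡ false
    at-v e ve = trans (cong (λ b → φ e ∧ not b) ve) (∧-zeroʳ (φ e))

  T'⊨A∷C : ∀ β → SatClause β A → T' β ⊨ (A ∷ C)
  T'⊨A∷C β βA γ γT' =
    SatClause-PARITY β γ A∈ βA (sat-restrict⇒agree (incident G v) (++⁻ʳ T γT')) ∷ T⊨C γ (++⁻ˡ T γT')

  -- T' β entails A ∷ C, so μ_T (T' β) ≤ μ (A ∷ C) = k'
  refutation-≤k' : ∀ β → SatTerm β T → violated β v ≡ false →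
                   ¬ ¬ Σ (Subset n) λ W → ∣ W ∣ ≤ k' × RefutedBy G χ (T' β) W
  refutation-≤k' β βT βv = do
    (j , μj@((W , ∣W∣≡j , refuted) , _)) ←
        termMeasure-exists (T' β) W₀ (λ γ γT' → refuted₀ γ (++⁻ˡ T γT'))
    pure (W , subst (_≤ k') (sym ∣W∣≡j) (proj₂ (proj₂ μ' satisfiable) (T' β) j (T'⊨A∷C β βA) μj) ,
          refuted)
    where
    W₀ = proj₁ (proj₁ μT)
    refuted₀ = proj₂ (proj₂ (proj₁ μT))
    βA = All.lookup (satisfied⇒sat-PARITY β v βv) A∈
    satisfiable : Satisfiable (A ∷ C)
    satisfiable = α₀ , α₀A ∷ T⊨C α₀ α₀T

  Small : Fin n → Set
  Small w = Σ (Fin n → Bool) λ X → Closed φ' X × X w ≡ true × d * card X ≤ K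

  φ'⇒φ : ∀ e → φ' e ≡ true → φ e ≡ true
  φ'⇒φ e = ∧-conicalˡ (φ e) _

  φ'⇒off-v : ∀ e → φ' e ≡ true → incidentᵇ G v e ≡ false
  φ'⇒off-v e φ'e = not-injective (∧-conicalʳ (φ e) _ φ'e)

  closed-φ⇒φ' : ∀ U → Closed φ U → Closed φ' U
  closed-φ⇒φ' U closed e = closed e ∘ φ'⇒φ e

  closed-φ'⇒φ : ∀ Y → Closed φ' Y →
                (∀ e → φ e ≡ true → incidentᵇ G v e ≡ true → Y (end₁ e) ≡ Y (end₂ e)) → Closed φ Y
  closed-φ'⇒φ Y closed' at-v e φe with incidentᵇ G v e in ve
  ... | true  = at-v e φe ve
  ... | false = closed' e (trans (cong (λ b → φ e ∧ not b) ve) (cong (_∧ true) φe))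

  closed-⁅v⁆ : Closed φ' ⁅ v ⁆
  closed-⁅v⁆ e φ'e = begin
    does (v ≟ end₁ e)     ≡⟨ does-≟-sym v (end₁ e) ⟩
    does (end₁ e ≟ v)     ≡⟨ ∨-conicalˡ _ _ off ⟩
    false                 ≡⟨ sym (∨-conicalʳ _ _ off) ⟩
    does (end₂ e ≟ v)     ≡⟨ does-≟-sym (end₂ e) v ⟩
    does (v ≟ end₂ e)     ∎
    where
    open ≡-Reasoning
    off = φ'⇒off-v e φ'e

  ends-at-v : ∀ U → Closed φ U → ∀ e → φ e ≡ true → incidentᵇ G v e ≡ true →
              U (end₁ e) ≡ U v × U (end₂ e) ≡ U v
  ends-at-v U closed e φe ve with incident-end ve
  ... | inj₁ refl = refl , sym (closed e φe)
  ... | inj₂ refl = closed e φe , refl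

  d*card∅≤K : d * card (∅ {n}) ≤ K
  d*card∅≤K = subst (_≤ K) (sym (trans (cong (d *_) (card-∅ {n})) (*-zeroʳ d))) z≤n

  module Near (N : Fin n → Bool) (N⇔ : ∀ w → N w ≡ true ⇔ (w ≡ v ⊎ Small w)) where

    Cover : (Fin n → Bool) → Set
    Cover U = Σ (Fin n → Bool) λ Y →
      Closed φ Y × (∃ λ u → U u ≡ true × Y u ≡ true) × card (U ∩ Y) < suc (suc K)

    cover-off-v : ∀ U → U ⊆ N → Closed φ U → charge α₀ U ≡ true → U v ≡ false → Cover U
    cover-off-v U U⊆N closed odd Uv with charge-violated α₀ U odd
    ... | w , Uw , _ with Equivalence.to (N⇔ w) (U⊆N w Uw)
    ...   | inj₁ refl = contradiction (trans (sym Uw) Uv) λ ()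
    ...   | inj₂ (X , closedX , Xw , dX≤K) =
      U ∩ X , closed-φ'⇒φ (U ∩ X) (closed-∩ U X (closed-φ⇒φ' U closed) closedX) at-v ,
      (w , Uw , cong₂ _∧_ Uw Xw) , s≤s (≤-trans size (n≤1+n K))
      where
      at-v : ∀ e → φ e ≡ true → incidentᵇ G v e ≡ true → (U ∩ X) (end₁ e) ≡ (U ∩ X) (end₂ e)
      at-v e φe ve = trans (cong (_∧ X (end₁ e)) (trans U₁ Uv)) (sym (cong (_∧ X (end₂ e)) (trans U₂ Uv)))
        where
        U₁ = proj₁ (ends-at-v U closed e φe ve)
        U₂ = proj₂ (ends-at-v U closed e φe ve)
      size : card (U ∩ (U ∩ X)) ≤ K
      size = begin
        card (U ∩ (U ∩ X))   ≤⟨ card-mono (U ∩ (U ∩ X)) X (λ u → ∩⊆ʳ U X u ∘ ∩⊆ʳ U (U ∩ X) u) ⟩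
        card X               ≤⟨ m≤n*m (card X) d ⟩
        d * card X           ≤⟨ dX≤K ⟩
        K                    ∎
        where open ≤-Reasoning

    v∈⁅v⁆∪ : ∀ {x} X → x ≡ v → (⁅ v ⁆ ∪ X) x ≡ true
    v∈⁅v⁆∪ X refl = cong (_∨ X v) (dec-true (v ≟ v) refl)

    near⇒covered : ∀ x → N x ≡ true →
                   Σ (Fin n → Bool) λ X → Closed φ' X × d * card X ≤ K × (⁅ v ⁆ ∪ X) x ≡ true
    near⇒covered x Nx with Equivalence.to (N⇔ x) Nx
    ... | inj₁ x≡v = ∅ , (λ _ _ → refl) , d*card∅≤K , v∈⁅v⁆∪ ∅ x≡v
    ... | inj₂ (X , closedX , Xx , bound) = X , closedX , bound , trans (cong (⁅ v ⁆ x ∨_) Xx) (∨-zeroʳ _)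

    record EdgeCover (e : Fin m) : Set where
      constructor mkEdgeCover
      field
        set    : Fin n → Bool
        closed : Closed φ' set
        small  : d * card set ≤ K
        ends   : φ e ≡ true → incidentᵇ G v e ≡ true →
                 (⁅ v ⁆ ∪ set) (end₁ e) ≡ true × (⁅ v ⁆ ∪ set) (end₂ e) ≡ true

    -- a free edge at v leaves v towards a vertex of U, hence of N
    edge-cover : ∀ U → U ⊆ N → Closed φ U → U v ≡ true → ∀ e → EdgeCover e
    edge-cover U U⊆N closed Uv e with φ e in φe | incidentᵇ G v e in ve
    ... | false | _     = mkEdgeCover ∅ (λ _ _ → refl) d*card∅≤K (λ φe' → contradiction (trans (sym φe) φe') λ ())
    ... | true  | false = mkEdgeCover ∅ (λ _ _ → refl) d*card∅≤K (λ _ ve' → contradiction (trans (sym ve) ve') λ ())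
    ... | true  | true  with incident-end ve
    ...   | inj₁ end₁≡v = let X , closedX , small , end₂∈ = near⇒covered (end₂ e) (U⊆N _ end₂∈U)
                          in mkEdgeCover X closedX small λ _ _ → v∈⁅v⁆∪ X end₁≡v , end₂∈
      where end₂∈U = trans (proj₂ (ends-at-v U closed e φe ve)) Uv
    ...   | inj₂ end₂≡v = let X , closedX , small , end₁∈ = near⇒covered (end₁ e) (U⊆N _ end₁∈U)
                          in mkEdgeCover X closedX small λ _ _ → end₁∈ , v∈⁅v⁆∪ X end₂≡v
      where end₁∈U = trans (proj₁ (ends-at-v U closed e φe ve)) Uv

    cover-at-v : ∀ U → U ⊆ N → Closed φ U → U v ≡ true → Cover U
    cover-at-v U U⊆N closed Uv = Y , closedY , (v , Uv , v∈⁅v⁆∪ (U ∩ S) refl) , s≤s size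
      where
      cover : ∀ e → EdgeCover e
      cover = edge-cover U U⊆N closed Uv
      X : Fin m → Fin n → Bool
      X e = EdgeCover.set (cover e)
      S = ⋃ (incident G v) X
      Y = ⁅ v ⁆ ∪ (U ∩ S)

      in-Y : ∀ {e x} → e ∈ incident G v → U x ≡ true → (⁅ v ⁆ ∪ X e) x ≡ true → Y x ≡ true
      in-Y {e} {x} e∈ Ux x∈ with ⁅ v ⁆ x
      ... | true  = refl
      ... | false = cong₂ _∧_ Ux (⊆-⋃ X e∈ x x∈)

      closedY : Closed φ Y
      closedY = closed-φ'⇒φ Y (closed-∪ ⁅ v ⁆ (U ∩ S) closed-⁅v⁆ (closed-∩ U S (closed-φ⇒φ' U closed) closedS))
                            at-v
        where
        closedS = closed-⋃ (incident G v) X (λ e _ → EdgeCover.closed (cover e))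
        at-v : ∀ e → φ e ≡ true → incidentᵇ G v e ≡ true → Y (end₁ e) ≡ Y (end₂ e)
        at-v e φe ve = trans (in-Y e∈ U₁ c₁) (sym (in-Y e∈ U₂ c₂))
          where
          e∈ = ∈-incident⁺ ve
          U₁ = trans (proj₁ (ends-at-v U closed e φe ve)) Uv
          U₂ = trans (proj₂ (ends-at-v U closed e φe ve)) Uv
          c₁ = proj₁ (EdgeCover.ends (cover e) φe ve)
          c₂ = proj₂ (EdgeCover.ends (cover e) φe ve)

      S-small : card S ≤ K
      S-small = *-cancelˡ-≤ d (begin
        d * card S                  ≤⟨ card-⋃ d K (incident G v) X (λ e _ → EdgeCover.small (cover e)) ⟩
        length (incident G v) * K   ≤⟨ *-monoˡ-≤ K (maxdeg v) ⟩
        d * K                       ∎)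
        where open ≤-Reasoning

      size : card (U ∩ Y) ≤ suc K
      size = begin
        card (U ∩ Y)                   ≤⟨ card-mono (U ∩ Y) Y (∩⊆ʳ U Y) ⟩
        card Y                         ≤⟨ card-∪ ⁅ v ⁆ (U ∩ S) ⟩
        card ⁅ v ⁆ + card (U ∩ S)      ≡⟨ cong (_+ card (U ∩ S)) (card-⁅⁆ v) ⟩
        suc (card (U ∩ S))             ≤⟨ s≤s (card-mono (U ∩ S) S (∩⊆ʳ U S)) ⟩
        suc (card S)                   ≤⟨ s≤s S-small ⟩
        suc K                          ∎
        where open ≤-Reasoning

    no-odd : ¬ Odd φ α₀ N
    no-odd = no-odd-by-descent φ α₀ N (suc (suc K)) odd⇒large cover
      where
      cover : ∀ U → U ⊆ N → Closed φ U → charge α₀ U ≡ true → Cover U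
      cover U U⊆N closed odd with U v in Uv
      ... | true  = cover-at-v U U⊆N closed Uv
      ... | false = cover-off-v U U⊆N closed odd Uv

    -- if d |U| ≤ K then U ⊆ N, where β satisfies every vertex
    odd⇒wide : ∀ β U → (∀ u → N u ≡ true → violated β u ≡ false) → Closed φ' U → charge β U ≡ true →
               K < d * card U
    odd⇒wide β U sat closed odd with d * card U ≤? K
    ... | no  wide  = ≰⇒> wide
    ... | yes small = contradiction (trans (sym odd) (charge-satisfied β U in-N)) λ ()
      where
      in-N : ∀ u → U u ≡ true → violated β u ≡ false
      in-N u Uu = sat u (Equivalence.from (N⇔ u) (inj₂ (U , closed , Uu , small)))

  bound : ¬ ¬ (suc (suc K) ≤ d * k' + 1)
  bound = do
    (N , N⇔) ← ¬¬-characteristic (λ w → w ≡ v ⊎ Small w)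
    let open Near N N⇔
    (β , agree , sat) ← even⇒satisfiable φ α₀ N no-odd
    let βT = agreeOff⇒sat T α₀T agree
    (W , ∣W∣≤k' , refuted) ← refutation-≤k' β βT (sat v (Equivalence.from (N⇔ v) (inj₁ refl)))
    (U , U⊆W , closed , odd) ← refutes⇒odd W (allows-T' β βT) refuted
    pure (begin
      suc (suc K)       ≡⟨ +-comm 1 (suc K) ⟩
      suc K + 1         ≤⟨ +-monoˡ-≤ 1 (odd⇒wide β U sat closed odd) ⟩
      d * card U + 1    ≤⟨ +-monoˡ-≤ 1 (*-monoʳ-≤ d (≤-trans (card-⊆-lookup U W U⊆W) ∣W∣≤k')) ⟩
      d * k' + 1        ∎)
    where open ≤-Reasoning

-- The argument is
-- classical; it runs in the double-negation monad, which suffices as the conclusion is decidable.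
lemma4p7 : ∀ {n m : ℕ} (G : Graph n m) (d : ℕ) (χ : Fin n → Bool) →
    Connected G → MaxDegreeAtMost G d → OddCharge G χ →
    (A : Clause m) → IsTseitinClause G χ A →
    (C : CNF m) → (k k' : ℕ) →
    IsMeasure G χ C k → IsMeasure G χ (A ∷ C) k' →
    d * k' + 1 ≥ k
lemma4p7 G d χ _ maxdeg _ A (v , A∈) C zero          k' _ _  = z≤n
lemma4p7 G d χ _ maxdeg _ A (v , A∈) C (suc zero)    k' _ _  = m≤n+m 1 (d * k')
lemma4p7 G d χ _ maxdeg _ A (v , A∈) C (suc (suc K)) k' μ μ' = decidable-stable (_ ≤? _) do
  yes satC ← ¬¬-excluded-middle {A = Satisfiable C}
    where no unsatC → contradiction (proj₁ μ (λ α αC → unsatC (α , αC))) λ ()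
  let T , T⊨C , μT = proj₁ (proj₂ μ satC)
  yes (α₀ , α₀T , α₀A) ← ¬¬-excluded-middle {A = ∃ λ α → SatTerm α T × SatClause α A}
    where no T⊭A →
            contradiction (termMeasure≤1 A∈ (λ α αT αA → T⊭A (α , αT , αA)) μT) λ { (s≤s ()) }
  Bound.bound G χ d maxdeg v A A∈ C k' μ' K T T⊨C μT α₀ α₀T α₀A
  where open Tseitin G χ
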